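{- Let $H=K_{k_1}\Box\cdots\Box K_{k_n}$ and let $G$ be an isometric daisy graph of $H$ with respect to $0^n$, where $H$ is the smallest possible. For every $\triangle$-class $F$ of $G$ there exists an edge $f\in F$ having $0^n$ as an endpoint.
   Context: $V(H)=\prod_{i=1}^n\{0,\dots,k_i-1\}$, vertices adjacent iff they differ in exactly one coordinate. The daisy graph $H_{0^n}(X)$ is the subgraph of $H$ induced by $\bigcup_{v\in X}I_H(0^n,v)$ ($I_H(a,b)$: vertices on shortest $a,b$-paths); isometric means distance-preserving. "$H$ is the smallest possible" means $G$ is not such a daisy graph of a Hamming graph with fewer or smaller factors. For an edge $uv$, $W_{uv}=\{x\in V(G): d_G(u,x)<d_G(v,x)\}$. Djoković relation: $uv\sim xy$ iff $x\in W_{uv}$ and $y\in W_{vu}$. Brešar's relation: $uv\,\triangle\,xy$ iff $uv\sim xy$ or there is a clique of $G$ containing edges $e,f$ with $xy\sim e$ and $uv\sim f$. In partial Hamming graphs (isometric subgraphs of Hamming graphs) $\triangle$ is an equivalence relation; its classes are the $\triangle$-classes. -}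

module Defs where

open import Level using (Level; 0ℓ) renaming (suc to lsuc)
open import Data.Nat using (ℕ; zero; suc; _+_; _≤_; _<_)
open import Data.Fin using (Fin)
open import Data.Vec using (Vec; lookup; replicate)
open import Data.Product using (Σ; ∃; _×_; _,_; proj₁; proj₂)
open import Data.Sum using (_⊎_)
open import Relation.Binary.PropositionalEquality using (_≡_; _≢_; subst)
open import Relation.Nullary using (¬_)

-- Generic notions for a graph whose vertices are those v : Vec ℕ n
-- satisfying Vtx v, with adjacency relation Adj (assumed to relate
-- only vertices satisfying Vtx).

module Graph {n : ℕ} (Vtx : Vec ℕ n → Set) (Adj : Vec ℕ n → Vec ℕ n → Set) where

  V : Set
  V = Vec ℕ n

  data Walk : V → V → ℕ → Set where
    []  : ∀ {u} → Walk u u 0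
    _∷_ : ∀ {u w v m} → Adj u w → Walk w v m → Walk u v (suc m)

  Dist : V → V → ℕ → Set
  Dist u v d = Walk u v d × (∀ m → Walk u v m → d ≤ m)

  W : V → V → V → Set
  W u v x = ∃ λ du → ∃ λ dv → Dist u x du × Dist v x dv × du < dv

  Dj : V → V → V → V → Set
  Dj u v x y = W u v x × W v u y

  DjE : V × V → V × V → Set
  DjE (u , v) (x , y) = Dj u v x y ⊎ Dj u v y x

  IsEdge : V × V → Set
  IsEdge (u , v) = Adj u v

  IsClique : (V → Set) → Set
  IsClique C = (∀ p → C p → Vtx p) × (∀ p q → C p → C q → p ≡ q ⊎ Adj p q)

  CommonClique : V × V → V × V → Set₁
  CommonClique (a , b) (c , d) =
    ∃ λ (C : V → Set) → IsClique C × C a × C b × C c × C d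

  Tri : V × V → V × V → Set₁
  Tri uv xy = DjE uv xy ⊎
    (∃ λ e → ∃ λ f → IsEdge e × IsEdge f × CommonClique e f × DjE xy e × DjE uv f)

-- Hamming graph H = K_{k_1} □ ... □ K_{k_n}; vertices are vectors
-- v with 0 ≤ v_i < k_i.

module Hamming (n : ℕ) (k : Vec ℕ n) where

  InH : Vec ℕ n → Set
  InH v = ∀ i → lookup v i < lookup k i

  zeroV : Vec ℕ n
  zeroV = replicate n 0

  AdjH : Vec ℕ n → Vec ℕ n → Set
  AdjH u v = InH u × InH v ×
    (∃ λ (i : Fin n) → (lookup u i ≢ lookup v i) × (∀ j → j ≢ i → lookup u j ≡ lookup v j))

  module H = Graph InH AdjH

  Interval : Vec ℕ n → Vec ℕ n → Vec ℕ n → Set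
  Interval a b x = ∃ λ d₁ → ∃ λ d₂ → H.Dist a x d₁ × H.Dist x b d₂ × H.Dist a b (d₁ + d₂)

  module Daisy (X : Vec ℕ n → Set) where

    InG : Vec ℕ n → Set
    InG v = InH v × (∃ λ x → X x × Interval zeroV x v)

    AdjG : Vec ℕ n → Vec ℕ n → Set
    AdjG u v = InG u × InG v × AdjH u v

    module G = Graph InG AdjG

    IsIsometricDaisy : Set
    IsIsometricDaisy = (∀ v → X v → InH v) ×
      (∀ u v → InG u → InG v → ∀ d → (G.Dist u v d → H.Dist u v d) × (H.Dist u v d → G.Dist u v d))

DaisyIso : (n : ℕ) (k : Vec ℕ n) (X : Vec ℕ n → Set)
           (m : ℕ) (k' : Vec ℕ m) (X' : Vec ℕ m → Set) → Set
DaisyIso n k X m k' X' =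
  ∃ λ (φ : Vec ℕ n → Vec ℕ m) → ∃ λ (ψ : Vec ℕ m → Vec ℕ n) →
    (∀ v → D.InG v → D'.InG (φ v)) ×
    (∀ w → D'.InG w → D.InG (ψ w)) ×
    (∀ v → D.InG v → ψ (φ v) ≡ v) ×
    (∀ w → D'.InG w → φ (ψ w) ≡ w) ×
    (∀ u v → D.InG u → D.InG v → (D.AdjG u v → D'.AdjG (φ u) (φ v)) × (D'.AdjG (φ u) (φ v) → D.AdjG u v))
  where
    module D  = Hamming.Daisy n k X
    module D' = Hamming.Daisy m k' X'

-- H' = K_{k'_1} □ ... □ K_{k'_m} has fewer factors than H, or the same
-- number of factors each of which is no larger, and at least one smaller.
SmallerHamming : (m : ℕ) (k' : Vec ℕ m) (n : ℕ) (k : Vec ℕ n) → Set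
SmallerHamming m k' n k =
  m < n ⊎ (Σ (m ≡ n) λ eq → (∀ i → lookup (subst (Vec ℕ) eq k') i ≤ lookup k i)
                            × (subst (Vec ℕ) eq k' ≢ k))

SmallestHamming : (n : ℕ) (k : Vec ℕ n) (X : Vec ℕ n → Set) → Set₁
SmallestHamming n k X =
  ∀ (m : ℕ) (k' : Vec ℕ m) (X' : Vec ℕ m → Set) →
    SmallerHamming m k' n k →
    Hamming.Daisy.IsIsometricDaisy m k' X' →
    ¬ DaisyIso n k X m k' X'

module Submission where

-- Distances in the Hamming graph H are Hamming distances of vectors (number
-- of differing coordinates), and since G is isometric the same holds in G.
-- Consequently, for an edge ab of G changing coordinate i, a vertex c with
-- c_i = a_i is strictly closer to a than to b; so two edges changing the same
-- coordinate i between the same two values are Djoković-related.  The vertex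
-- set of a daisy graph is closed under moving coordinates back to 0, which
-- supplies the needed vertices: if uv changes coordinate i and u_i = 0 (or
-- v_i = 0), then uv is parallel to the edge 0^n (0^n)[i ↦ v_i] (resp. its
-- reverse); otherwise u' = u[i ↦ 0], u, v form a triangle, and the edge
-- 0^n (0^n)[i ↦ u_i] is parallel to u'u, giving △ through that clique.

open import Defs
open import Data.Nat using (ℕ; zero; suc; _+_; _≤_; _<_; _≟_; z≤n; s≤s)
open import Data.Nat.Properties
  using (≤-refl; ≤-reflexive; ≤-trans; ≤-antisym; +-mono-≤; +-monoʳ-≤; +-monoʳ-<;
         +-cancelʳ-≤; +-cancelˡ-≡; +-identityʳ; suc-injective; 1+n≢0; +-commutativeSemigroup)
open import Algebra.Properties.CommutativeSemigroup +-commutativeSemigroup using (interchange)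
open import Data.Fin using (Fin; zero; suc)
import Data.Fin.Properties as Finₚ
open import Data.Vec using (Vec; []; _∷_; lookup; tabulate; _[_]≔_)
open import Data.Vec.Properties
  using (lookup∘update; lookup∘update′; lookup-replicate; tabulate∘lookup; tabulate-cong)
open import Data.Product using (∃; _×_; _,_; proj₁; proj₂)
open import Data.Sum using (_⊎_; inj₁; inj₂)
open import Data.Empty using (⊥-elim)
open import Relation.Nullary using (¬_; yes; no)
open import Relation.Binary.PropositionalEquality

δ : ℕ → ℕ → ℕ
δ x y with x ≟ y
... | yes _ = 0
... | no  _ = 1

δ-≡ : ∀ {x y} → x ≡ y → δ x y ≡ 0
δ-≡ {x} {y} x≡y with x ≟ y
... | yes _   = refl
... | no  x≢y = ⊥-elim (x≢y x≡y)

δ-≢ : ∀ {x y} → x ≢ y → δ x y ≡ 1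
δ-≢ {x} {y} x≢y with x ≟ y
... | yes x≡y = ⊥-elim (x≢y x≡y)
... | no  _   = refl

δ≤1 : ∀ x y → δ x y ≤ 1
δ≤1 x y with x ≟ y
... | yes _ = z≤n
... | no  _ = s≤s z≤n

δ-triangle : ∀ x y z → δ x y ≤ δ x z + δ z y
δ-triangle x y z with x ≟ y
... | yes _ = z≤n
... | no x≢y with x ≟ z
...   | no  _    = s≤s z≤n
...   | yes refl rewrite δ-≢ x≢y = s≤s z≤n

δ-between : ∀ x z y → δ x z + δ z y ≡ δ x y → z ≡ x ⊎ z ≡ y
δ-between x z y eq with z ≟ x | z ≟ y
... | yes z≡x | _       = inj₁ z≡x
... | no  _   | yes z≡y = inj₂ z≡y
... | no  z≢x | no  _ rewrite δ-≢ (λ x≡z → z≢x (sym x≡z)) =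
  ⊥-elim (2≰1 (subst (_≤ 1) (sym eq) (δ≤1 x y)))
  where
  2≰1 : ¬ (2 ≤ 1)
  2≰1 (s≤s ())

-- Hamming distance of vectors

hd : ∀ {n} → Vec ℕ n → Vec ℕ n → ℕ
hd []       []       = 0
hd (x ∷ xs) (y ∷ ys) = δ x y + hd xs ys

AgreeOff : ∀ {n} → Vec ℕ n → Vec ℕ n → Fin n → Set
AgreeOff a b i = ∀ j → j ≢ i → lookup a j ≡ lookup b j

Between : ∀ {n} → Vec ℕ n → Vec ℕ n → Vec ℕ n → Set
Between a t b = ∀ j → lookup t j ≡ lookup a j ⊎ lookup t j ≡ lookup b j

pointwise⇒≡ : ∀ {n} {a b : Vec ℕ n} → (∀ j → lookup a j ≡ lookup b j) → a ≡ b
pointwise⇒≡ {a = a} {b} same = begin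
  a                  ≡⟨ sym (tabulate∘lookup a) ⟩
  tabulate (lookup a) ≡⟨ tabulate-cong same ⟩
  tabulate (lookup b) ≡⟨ tabulate∘lookup b ⟩
  b                  ∎
  where open ≡-Reasoning

agreeOff-tail : ∀ {n x y} {a b : Vec ℕ n} {i} → AgreeOff (x ∷ a) (y ∷ b) (suc i) → AgreeOff a b i
agreeOff-tail agree j j≢i = agree (suc j) (λ sj≡si → j≢i (Finₚ.suc-injective sj≡si))

agreeOff-head : ∀ {n x y} {a b : Vec ℕ n} → AgreeOff (x ∷ a) (y ∷ b) zero → a ≡ b
agreeOff-head agree = pointwise⇒≡ (λ j → agree (suc j) (λ ()))

hd-refl : ∀ {n} (a : Vec ℕ n) → hd a a ≡ 0
hd-refl []      = refl
hd-refl (x ∷ a) rewrite δ-≡ {x} refl = hd-refl a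

hd≡0⇒≡ : ∀ {n} (a b : Vec ℕ n) → hd a b ≡ 0 → a ≡ b
hd≡0⇒≡ []      []      _  = refl
hd≡0⇒≡ (x ∷ a) (y ∷ b) eq with x ≟ y
... | yes refl = cong (x ∷_) (hd≡0⇒≡ a b eq)
... | no  _    = ⊥-elim (1+n≢0 eq)

hd-triangle : ∀ {n} (a b c : Vec ℕ n) → hd a b ≤ hd a c + hd c b
hd-triangle []      []      []      = z≤n
hd-triangle (x ∷ a) (y ∷ b) (z ∷ c) =
  subst (δ x y + hd a b ≤_) (interchange (δ x z) (δ z y) (hd a c) (hd c b))
    (+-mono-≤ (δ-triangle x y z) (hd-triangle a b c))

hd-agreeOff : ∀ {n} (a c : Vec ℕ n) i → AgreeOff a c i → hd a c ≤ 1
hd-agreeOff (x ∷ a) (y ∷ c) zero agree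
  rewrite agreeOff-head agree | hd-refl c | +-identityʳ (δ x y) = δ≤1 x y
hd-agreeOff (x ∷ a) (y ∷ c) (suc i) agree
  rewrite δ-≡ (agree zero (λ ())) = hd-agreeOff a c i (agreeOff-tail agree)

hd-step : ∀ {n} (a b : Vec ℕ n) m → hd a b ≡ suc m →
  ∃ λ i → (lookup a i ≢ lookup b i) × (hd (a [ i ]≔ lookup b i) b ≡ m)
hd-step []      []      m ()
hd-step (x ∷ a) (y ∷ b) m eq with x ≟ y
... | no x≢y = zero , x≢y , trans (cong (_+ hd a b) (δ-≡ {y} refl)) (suc-injective eq)
... | yes refl with hd-step a b m eq
...   | i , differ , eq′ =
  suc i , differ , trans (cong (_+ hd (a [ i ]≔ lookup b i) b) (δ-≡ {x} refl)) eq′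

tight-sum : ∀ {a b A B} → a ≤ A → b ≤ B → A + B ≡ a + b → A ≡ a × B ≡ b
tight-sum {a} {b} {A} {B} a≤A b≤B eq = A≡a , +-cancelˡ-≡ a B b (trans (cong (_+ B) (sym A≡a)) eq)
  where
  A≡a : A ≡ a
  A≡a = ≤-antisym (+-cancelʳ-≤ b A a (≤-trans (+-monoʳ-≤ A b≤B) (≤-reflexive eq))) a≤A

hd-additive⇒between : ∀ {n} (a t b : Vec ℕ n) → hd a t + hd t b ≡ hd a b → Between a t b
hd-additive⇒between (x ∷ a) (z ∷ t) (y ∷ b) eq j
  with tight-sum (δ-triangle x y z) (hd-triangle a b t)
                 (trans (sym (interchange (δ x z) (hd a t) (δ z y) (hd t b))) eq)
hd-additive⇒between (x ∷ a) (z ∷ t) (y ∷ b) eq zero    | head , _ = δ-between x z y head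
hd-additive⇒between (x ∷ a) (z ∷ t) (y ∷ b) eq (suc j) | _ , tail = hd-additive⇒between a t b tail j

between⇒hd-additive : ∀ {n} (a t b : Vec ℕ n) → Between a t b → hd a t + hd t b ≡ hd a b
between⇒hd-additive []      []      []      _   = refl
between⇒hd-additive (x ∷ a) (z ∷ t) (y ∷ b) btw =
  trans (interchange (δ x z) (hd a t) (δ z y) (hd t b))
        (cong₂ _+_ (head (btw zero)) (between⇒hd-additive a t b (λ j → btw (suc j))))
  where
  head : z ≡ x ⊎ z ≡ y → δ x z + δ z y ≡ δ x y
  head (inj₁ refl) rewrite δ-≡ {z} refl = refl
  head (inj₂ refl) rewrite δ-≡ {z} refl = +-identityʳ _

between-trans : ∀ {n} {a t y b : Vec ℕ n} → Between a t b → Between a y t → Between a y b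
between-trans t∈ab y∈at j with y∈at j
... | inj₁ y≡a = inj₁ y≡a
... | inj₂ y≡t with t∈ab j
...   | inj₁ t≡a = inj₁ (trans y≡t t≡a)
...   | inj₂ t≡b = inj₂ (trans y≡t t≡b)

update-between : ∀ {n} (a b : Vec ℕ n) i → Between a (a [ i ]≔ lookup b i) b
update-between a b i j with j Finₚ.≟ i
... | yes refl = inj₂ (lookup∘update j a (lookup b j))
... | no  j≢i  = inj₁ (lookup∘update′ j≢i a (lookup b i))

update-between′ : ∀ {n} (a b : Vec ℕ n) i → Between a (b [ i ]≔ lookup a i) b
update-between′ a b i j with j Finₚ.≟ i
... | yes refl = inj₁ (lookup∘update j b (lookup a j))
... | no  j≢i  = inj₂ (lookup∘update′ j≢i b (lookup a i))

update-agreeOff : ∀ {n} (a : Vec ℕ n) i x → AgreeOff a (a [ i ]≔ x) i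
update-agreeOff a i x j j≢i = sym (lookup∘update′ j≢i a x)

hd-closer : ∀ {n} (a b c : Vec ℕ n) i → AgreeOff a b i → lookup a i ≢ lookup b i →
  lookup c i ≡ lookup a i → hd a c < hd b c
hd-closer (x ∷ a) (y ∷ b) (z ∷ c) zero agree x≢y z≡x
  rewrite agreeOff-head agree | δ-≡ (sym z≡x) | δ-≢ (λ y≡z → x≢y (trans (sym z≡x) (sym y≡z)))
  = ≤-refl
hd-closer (x ∷ a) (y ∷ b) (z ∷ c) (suc i) agree differ c≡a
  rewrite agree zero (λ ()) = +-monoʳ-< (δ y z) (hd-closer a b c i (agreeOff-tail agree) differ c≡a)

-- Distances and intervals in the Hamming graph

module HammingMetric (n : ℕ) (k : Vec ℕ n) where
  open Hamming n k

  InH-update : ∀ a i x → InH a → x < lookup k i → InH (a [ i ]≔ x)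
  InH-update a i x a∈H x<k j with j Finₚ.≟ i
  ... | yes refl = subst (_< lookup k j) (sym (lookup∘update j a x)) x<k
  ... | no  j≢i  = subst (_< lookup k j) (sym (lookup∘update′ j≢i a x)) (a∈H j)

  InH-between : ∀ {a t b} → InH a → InH b → Between a t b → InH t
  InH-between {a} {t} {b} a∈H b∈H btw j with btw j
  ... | inj₁ t≡a = subst (_< lookup k j) (sym t≡a) (a∈H j)
  ... | inj₂ t≡b = subst (_< lookup k j) (sym t≡b) (b∈H j)

  walk-length≥hd : ∀ {a b m} → H.Walk a b m → hd a b ≤ m
  walk-length≥hd {a} H.[] = ≤-reflexive (hd-refl a)
  walk-length≥hd {a} {b} (H._∷_ {w = c} (_ , _ , i , _ , agree) walk) =
    ≤-trans (hd-triangle a b c) (+-mono-≤ (hd-agreeOff a c i agree) (walk-length≥hd walk))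

  geodesic : ∀ m a b → hd a b ≡ m → InH a → InH b → H.Walk a b m
  geodesic zero    a b eq a∈H b∈H rewrite hd≡0⇒≡ a b eq = H.[]
  geodesic (suc m) a b eq a∈H b∈H with hd-step a b m eq
  ... | i , differ , eq′ = first-step H.∷ geodesic m a′ b eq′ a′∈H b∈H
    where
    a′ = a [ i ]≔ lookup b i
    a′∈H = InH-update a i (lookup b i) a∈H (b∈H i)
    first-step : AdjH a a′
    first-step = a∈H , a′∈H , i ,
      subst (lookup a i ≢_) (sym (lookup∘update i a (lookup b i))) differ ,
      update-agreeOff a i (lookup b i)

  dist-hd : ∀ a b → InH a → InH b → H.Dist a b (hd a b)
  dist-hd a b a∈H b∈H = geodesic _ a b refl a∈H b∈H , λ _ walk → walk-length≥hd walk

  dist⇒hd : ∀ {a b d} → InH a → InH b → H.Dist a b d → d ≡ hd a b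
  dist⇒hd {a} {b} a∈H b∈H (walk , shortest) =
    ≤-antisym (shortest _ (geodesic _ a b refl a∈H b∈H)) (walk-length≥hd walk)

  interval⇒between : ∀ {a b t} → InH a → InH b → InH t → Interval a b t → Between a t b
  interval⇒between {a} {b} {t} a∈H b∈H t∈H (_ , _ , d₁ , d₂ , d) =
    hd-additive⇒between a t b
      (trans (sym (cong₂ _+_ (dist⇒hd a∈H t∈H d₁) (dist⇒hd t∈H b∈H d₂))) (dist⇒hd a∈H b∈H d))

  between⇒interval : ∀ {a b t} → InH a → InH b → Between a t b → Interval a b t
  between⇒interval {a} {b} {t} a∈H b∈H btw =
    hd a t , hd t b , dist-hd a t a∈H t∈H , dist-hd t b t∈H b∈H ,
    subst (H.Dist a b) (sym (between⇒hd-additive a t b btw)) (dist-hd a b a∈H b∈H)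
    where
    t∈H = InH-between {a} {t} {b} a∈H b∈H btw

module Triangle {n : ℕ} (Vtx : Vec ℕ n → Set) (Adj : Vec ℕ n → Vec ℕ n → Set)
                (Adj-sym : ∀ {p q} → Adj p q → Adj q p) where
  open Graph Vtx Adj

  triangle-clique : ∀ {a b c} → Vtx a → Vtx b → Vtx c → Adj a b → Adj b c → Adj a c →
    CommonClique (a , b) (b , c)
  triangle-clique {a} {b} {c} a∈ b∈ c∈ ab bc ac =
    T , (vertices , adjacent) , inj₁ refl , inj₂ (inj₁ refl) , inj₂ (inj₁ refl) , inj₂ (inj₂ refl)
    where
    T : Vec ℕ n → Set
    T p = p ≡ a ⊎ p ≡ b ⊎ p ≡ c
    vertices : ∀ p → T p → Vtx p
    vertices _ (inj₁ refl)        = a∈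
    vertices _ (inj₂ (inj₁ refl)) = b∈
    vertices _ (inj₂ (inj₂ refl)) = c∈
    adjacent : ∀ p q → T p → T q → p ≡ q ⊎ Adj p q
    adjacent _ _ (inj₁ refl)        (inj₁ refl)        = inj₁ refl
    adjacent _ _ (inj₁ refl)        (inj₂ (inj₁ refl)) = inj₂ ab
    adjacent _ _ (inj₁ refl)        (inj₂ (inj₂ refl)) = inj₂ ac
    adjacent _ _ (inj₂ (inj₁ refl)) (inj₁ refl)        = inj₂ (Adj-sym ab)
    adjacent _ _ (inj₂ (inj₁ refl)) (inj₂ (inj₁ refl)) = inj₁ refl
    adjacent _ _ (inj₂ (inj₁ refl)) (inj₂ (inj₂ refl)) = inj₂ bc
    adjacent _ _ (inj₂ (inj₂ refl)) (inj₁ refl)        = inj₂ (Adj-sym ac)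
    adjacent _ _ (inj₂ (inj₂ refl)) (inj₂ (inj₁ refl)) = inj₂ (Adj-sym bc)
    adjacent _ _ (inj₂ (inj₂ refl)) (inj₂ (inj₂ refl)) = inj₁ refl

-- Isometric daisy graphs

module IsometricDaisy (n : ℕ) (k : Vec ℕ n) (X : Vec ℕ n → Set)
  (positive : ∀ i → 0 < lookup k i)
  (isometric : Hamming.Daisy.IsIsometricDaisy n k X) where
  open Hamming n k
  open Daisy X
  open HammingMetric n k

  0∈H : InH zeroV
  0∈H j = subst (_< lookup k j) (sym (lookup-replicate j 0)) (positive j)

  -- V(G) is closed under moving towards the root: if t ∈ G and y lies
  -- between 0^n and t, then y ∈ G (as t ∈ I(0^n,x) gives y ∈ I(0^n,x)).
  retract∈G : ∀ {t y} → InG t → Between zeroV y t → InG y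
  retract∈G {t} {y} (t∈H , x , x∈X , t∈I) y∈0t = y∈H , x , x∈X , between⇒interval 0∈H x∈H y∈0x
    where
    x∈H : InH x
    x∈H = proj₁ isometric x x∈X
    y∈0x : Between zeroV y x
    y∈0x = between-trans {a = zeroV} {t} {y} {x} (interval⇒between 0∈H x∈H t∈H t∈I) y∈0t
    y∈H : InH y
    y∈H = InH-between {zeroV} {y} {x} 0∈H x∈H y∈0x

  distG : ∀ a c → InG a → InG c → G.Dist a c (hd a c)
  distG a c a∈G c∈G =
    proj₂ (proj₂ isometric a c a∈G c∈G (hd a c)) (dist-hd a c (proj₁ a∈G) (proj₁ c∈G))

  EdgeAt : Fin n → Vec ℕ n → Vec ℕ n → Set
  EdgeAt i a b = InG a × InG b × lookup a i ≢ lookup b i × AgreeOff a b i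

  edgeAt⇒adj : ∀ {i a b} → EdgeAt i a b → AdjG a b
  edgeAt⇒adj {i} (a∈G , b∈G , differ , agree) = a∈G , b∈G , proj₁ a∈G , proj₁ b∈G , i , differ , agree

  edgeAt-sym : ∀ {i a b} → EdgeAt i a b → EdgeAt i b a
  edgeAt-sym (a∈G , b∈G , differ , agree) =
    b∈G , a∈G , (λ eq → differ (sym eq)) , (λ j j≢i → sym (agree j j≢i))

  AdjG-sym : ∀ {a b} → AdjG a b → AdjG b a
  AdjG-sym (a∈G , b∈G , _ , _ , i , differ , agree) = edgeAt⇒adj (edgeAt-sym (a∈G , b∈G , differ , agree))

  inW : ∀ {i a b c} → EdgeAt i a b → InG c → lookup c i ≡ lookup a i → G.W a b c
  inW {i} {a} {b} {c} (a∈G , b∈G , differ , agree) c∈G c≡a =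
    hd a c , hd b c , distG a c a∈G c∈G , distG b c b∈G c∈G , hd-closer a b c i agree differ c≡a

  parallel : ∀ {i a b c d} → EdgeAt i a b → InG c → InG d →
    lookup c i ≡ lookup a i → lookup d i ≡ lookup b i → G.Dj a b c d
  parallel ab c∈G d∈G c≡a d≡b = inW ab c∈G c≡a , inW (edgeAt-sym ab) d∈G d≡b

  rootEdge : ∀ {t} i → InG t → lookup t i ≢ lookup zeroV i →
    EdgeAt i zeroV (zeroV [ i ]≔ lookup t i)
  rootEdge {t} i t∈G t≢0 =
    retract∈G t∈G (λ j → inj₁ refl) ,
    retract∈G t∈G (update-between zeroV t i) ,
    (λ eq → t≢0 (sym (trans eq (lookup∘update i zeroV (lookup t i))))) ,
    update-agreeOff zeroV i (lookup t i)

  resetEdge : ∀ {t} i → InG t → lookup t i ≢ lookup zeroV i →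
    EdgeAt i (t [ i ]≔ lookup zeroV i) t
  resetEdge {t} i t∈G t≢0 =
    edgeAt-sym (t∈G , retract∈G t∈G (update-between′ zeroV t i) ,
                (λ eq → t≢0 (trans eq (lookup∘update i t (lookup zeroV i)))) ,
                update-agreeOff t i (lookup zeroV i))

  open Triangle InG AdjG AdjG-sym

  △-root-edge : ∀ u v → AdjG u v → ∃ λ w → AdjG zeroV w × G.Tri (u , v) (zeroV , w)
  △-root-edge u v (u∈G , v∈G , _ , _ , i , u≢v , agree)
    with lookup u i ≟ lookup zeroV i | lookup v i ≟ lookup zeroV i
  ... | yes u≡0 | _ =
    -- uv is parallel to the root edge towards v_i
    _ , edgeAt⇒adj root ,
    inj₁ (inj₁ (parallel uv (proj₁ root) (proj₁ (proj₂ root)) (sym u≡0)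
                         (lookup∘update i zeroV (lookup v i))))
    where
    uv = u∈G , v∈G , u≢v , agree
    root = rootEdge i v∈G (λ v≡0 → u≢v (trans u≡0 (sym v≡0)))
  ... | no u≢0 | yes v≡0 =
    -- uv is parallel to the reversed root edge towards u_i
    _ , edgeAt⇒adj root ,
    inj₁ (inj₂ (parallel uv (proj₁ (proj₂ root)) (proj₁ root)
                         (lookup∘update i zeroV (lookup u i)) (sym v≡0)))
    where
    uv = u∈G , v∈G , u≢v , agree
    root = rootEdge i u∈G u≢0
  ... | no u≢0 | no v≢0 =
    -- u′ = u[i ↦ 0], u, v form a triangle; the root edge is parallel to u′u
    _ , edgeAt⇒adj root ,
    inj₂ ((u′ , u) , (u , v) , edgeAt⇒adj u′u , edgeAt⇒adj uv ,
          triangle-clique u′∈G u∈G v∈G (edgeAt⇒adj u′u) (edgeAt⇒adj uv) (edgeAt⇒adj u′v) ,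
          inj₁ (parallel root u′∈G u∈G (lookup∘update i u (lookup zeroV i))
                         (sym (lookup∘update i zeroV (lookup u i)))) ,
          inj₁ (parallel uv u∈G v∈G refl refl))
    where
    uv = u∈G , v∈G , u≢v , agree
    root = rootEdge i u∈G u≢0
    u′ = u [ i ]≔ lookup zeroV i
    u′u = resetEdge i u∈G u≢0
    u′∈G = proj₁ u′u
    u′v : EdgeAt i u′ v
    u′v = u′∈G , v∈G ,
          (λ eq → v≢0 (sym (trans (sym (lookup∘update i u (lookup zeroV i))) eq))) ,
          (λ j j≢i → trans (lookup∘update′ j≢i u (lookup zeroV i)) (agree j j≢i))

-- The theorem: every △-class of G contains an edge at the root 0^n.

lemma3p3 : (n : ℕ) (k : Vec ℕ n) (X : Vec ℕ n → Set) →
    (∀ i → 0 < lookup k i) →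
    Hamming.Daisy.IsIsometricDaisy n k X →
    SmallestHamming n k X →
    ∀ u v → Hamming.Daisy.AdjG n k X u v →
    ∃ λ w → Hamming.Daisy.AdjG n k X (Hamming.zeroV n k) w ×
    Graph.Tri (Hamming.Daisy.InG n k X) (Hamming.Daisy.AdjG n k X) (u , v) (Hamming.zeroV n k , w)
lemma3p3 n k X positive isometric _ = IsometricDaisy.△-root-edge n k X positive isometric
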